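{- Let $n\ge 1$ and let $e$ be an $n$-transversal edge of the $n$-dimensional varietal hypercube $VQ_n$. Then $e$ is contained in some cycle of length $5$ if $n=3k$ for some integer $k\ge 1$, and $e$ is not contained in any cycle of length $5$ if $n$ is not a multiple of $3$.
   Context: The $n$-dimensional varietal hypercube $VQ_n$ is defined recursively on the vertex set of binary strings of length $n$. $VQ_1$ is the complete graph on the two vertices $0$ and $1$. For $n>1$, let $VQ^0_{n-1}$ (resp. $VQ^1_{n-1}$) be the graph obtained from $VQ_{n-1}$ by prefixing $0$ (resp. $1$) to every vertex label. $VQ_n$ consists of $VQ^0_{n-1}$ and $VQ^1_{n-1}$ together with the following edges, called $n$-transversal edges: a vertex $x=0x_{n-1}\cdots x_1$ and a vertex $y=1y_{n-1}\cdots y_1$ are adjacent if and only if either (1) $n$ is not a multiple of $3$ and $x_{n-1}\cdots x_1=y_{n-1}\cdots y_1$, or (2) $n$ is a multiple of $3$, $x_{n-3}\cdots x_1=y_{n-3}\cdots y_1$ and $(x_{n-1}x_{n-2},y_{n-1}y_{n-2})\in\{(00,00),(01,01),(10,11),(11,10)\}$. (For $n=1$ the single edge $01$ is the $1$-transversal edge.) -}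

module Defs where

open import Data.Nat using (ℕ; zero; suc)
open import Data.Nat.Divisibility using (_∣_)
open import Data.Bool using (Bool; true; false)
open import Data.Vec using (Vec; []; _∷_)
open import Data.Fin using (Fin; zero; suc)
open import Data.Product using (_×_; Σ-syntax; proj₁)
open import Data.Sum using (_⊎_)
open import Data.Empty using (⊥)
open import Relation.Nullary using (¬_)
open import Relation.Binary.PropositionalEquality using (_≡_; _≢_)
open import Function.Definitions using (Injective)

-- Vertices of VQ_n: binary strings x_n x_{n-1} ... x_1, stored as a
-- vector whose head is the leading (most significant) bit x_n.
Vertex : ℕ → Set
Vertex n = Vec Bool n

-- Special rule used when the dimension is a multiple of 3:
-- tails x_{n-1} x_{n-2} w and y_{n-1} y_{n-2} w' are related iff w = w'
-- and (x_{n-1}x_{n-2}, y_{n-1}y_{n-2}) ∈ {(00,00),(01,01),(10,11),(11,10)}.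
Special : (m : ℕ) → Vec Bool m → Vec Bool m → Set
Special (suc (suc m)) (p ∷ q ∷ r) (p' ∷ q' ∷ r') =
  p ≡ p' × r ≡ r' × PairRule p q q'
  where
  PairRule : Bool → Bool → Bool → Set
  PairRule false a b = a ≡ b
  PairRule true  a b = a ≢ b
Special _ _ _ = ⊥

-- TransRel m x y : the vertices 0x and 1y (x y of length m) are joined by
-- a (suc m)-transversal edge in VQ_{suc m}.
TransRel : (m : ℕ) → Vec Bool m → Vec Bool m → Set
TransRel m x y = ((¬ (3 ∣ suc m)) → x ≡ y) × ((3 ∣ suc m) → Special m x y)

Adj : (n : ℕ) → Vertex n → Vertex n → Set
Adj zero [] [] = ⊥
Adj (suc m) (a ∷ x) (b ∷ y) = (a ≡ b × Adj m x y) ⊎ (a ≢ b × TransRel m x y)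

next5 : Fin 5 → Fin 5
next5 zero = suc zero
next5 (suc zero) = suc (suc zero)
next5 (suc (suc zero)) = suc (suc (suc zero))
next5 (suc (suc (suc zero))) = suc (suc (suc (suc zero)))
next5 (suc (suc (suc (suc zero)))) = zero

Cycle5 : ℕ → Set
Cycle5 n = Σ[ f ∈ (Fin 5 → Vertex n) ]
  (Injective _≡_ _≡_ f × ((i : Fin 5) → Adj n (f i) (f (next5 i))))

OnSomeCycle5 : (n : ℕ) → Vertex n → Vertex n → Set
OnSomeCycle5 n u v = Σ[ c ∈ Cycle5 n ]
  (proj₁ c zero ≡ u × proj₁ c (suc zero) ≡ v)

module Submission where

-- Write n = suc m.  An n-transversal edge joins 0x and 1y.  When 3 ∤ n it
-- simply joins 0x and 1x; when 3 ∣ n it joins 0x and 1(twist x), where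
-- twist (a ∷ b ∷ r) = a ∷ (a xor b) ∷ r.  In both cases the transversal
-- relation is symmetric and every vertex has at most one transversal
-- neighbour.
--
-- From this we first show that every VQ_m is triangle-free: a triangle
-- either lies in one half (induction), or has exactly two transversal
-- edges meeting in a vertex, whose two transversal neighbours would then
-- coincide although they are adjacent.
--
-- Non-existence (3 ∤ n): a 5-cycle through 0x, 1x gives a path
-- 1x, v₂, v₃, v₄, 0x with v₂ ≠ 0x and v₄ ≠ 1x.  Since 1x and 0x have no
-- other transversal neighbours, its leading bits read 1, 1, ?, 0, 0, and
-- dropping them yields a triangle through x in VQ_m.
--
-- Existence (3 ∣ n): for x = a ∷ b ∷ r the vertices 0ab, 1a(a xor b),
-- 1(¬a)(a xor b), 0(¬a)(¬b), 0a(¬b) (all followed by r) form a 5-cycle;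
-- it only uses that 3 ∤ n-1 and 3 ∤ n-2.  Its vertices are told apart by
-- their first three bits read relative to a and b.

open import Defs
open import Data.Nat using (ℕ; zero; suc; _+_; _<_; s≤s; z≤n; NonZero)
open import Data.Nat.Divisibility using (_∣_; _∣?_; ∣m+n∣m⇒∣n; >⇒∤)
open import Data.Nat.Properties using (+-comm)
open import Data.Bool using (Bool; true; false; not; _xor_)
open import Data.Bool.Properties using (xor-same; xor-inverseʳ; not-¬; ¬-not)
open import Data.Vec using (Vec; []; _∷_)
open import Data.Fin using (Fin; zero; suc)
open import Data.Product using (_×_; _,_; proj₁)
open import Data.Sum using (inj₁; inj₂)
open import Data.Empty using (⊥; ⊥-elim)
open import Relation.Nullary using (¬_; yes; no)
open import Relation.Binary.PropositionalEquality
  using (_≡_; _≢_; refl; sym; trans; cong; cong₂; subst)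
open import Function.Definitions using (Injective)
open import Function.Consequences.Propositional
  using (inverseʳ⇒injective; strictlyInverseʳ⇒inverseʳ)

∤-shift : ∀ {d j n} .{{_ : NonZero j}} → j < d → d ∣ j + n → ¬ d ∣ n
∤-shift {d} {j} {n} j<d d∣j+n d∣n =
  >⇒∤ j<d (∣m+n∣m⇒∣n (subst (d ∣_) (+-comm j n) d∣j+n) d∣n)

3∤n-1 : ∀ {k} → 3 ∣ 3 + k → ¬ 3 ∣ 2 + k
3∤n-1 = ∤-shift (s≤s (s≤s z≤n))

3∤n-2 : ∀ {k} → 3 ∣ 3 + k → ¬ 3 ∣ 1 + k
3∤n-2 = ∤-shift (s≤s (s≤s (s≤s z≤n)))

3∤1 : ¬ 3 ∣ 1
3∤1 = >⇒∤ (s≤s (s≤s z≤n))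

3∤2 : ¬ 3 ∣ 2
3∤2 = >⇒∤ (s≤s (s≤s (s≤s z≤n)))

not-xor-xor : ∀ a b → not a xor (a xor b) ≡ not b
not-xor-xor false b = refl
not-xor-xor true  b = refl

≢-not : ∀ {a} → a ≢ not a
≢-not = not-¬ refl

not-≢ : ∀ {a} → not a ≢ a
not-≢ e = ≢-not (sym e)

-- The transversal partner in a dimension divisible by 3: flip the second
-- bit exactly when the first one is set.  (Shorter strings never occur.)
twist : ∀ {m} → Vec Bool m → Vec Bool m
twist (a ∷ b ∷ r) = a ∷ (a xor b) ∷ r
twist x           = x

special⇒twist : ∀ {m} {x y : Vec Bool m} → Special m x y → y ≡ twist x
special⇒twist {suc (suc m)} {false ∷ b ∷ r} {_ ∷ _ ∷ _} (refl , refl , b≡b') =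
  cong (λ c → false ∷ c ∷ r) (sym b≡b')
special⇒twist {suc (suc m)} {true  ∷ b ∷ r} {_ ∷ _ ∷ _} (refl , refl , b≢b') =
  cong (λ c → true ∷ c ∷ r) (¬-not (λ e → b≢b' (sym e)))

twist-special : ∀ {k} (x : Vec Bool (2 + k)) → Special (2 + k) x (twist x)
twist-special (false ∷ b ∷ r) = refl , refl , refl
twist-special (true  ∷ b ∷ r) = refl , refl , ≢-not

special-sym : ∀ {m} {x y : Vec Bool m} → Special m x y → Special m y x
special-sym {suc (suc m)} {false ∷ _ ∷ _} {_ ∷ _ ∷ _} (refl , refl , e) = refl , refl , sym e
special-sym {suc (suc m)} {true  ∷ _ ∷ _} {_ ∷ _ ∷ _} (refl , refl , e) = refl , refl , λ e' → e (sym e')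

transversal-same : ∀ {m} {x : Vec Bool m} → ¬ 3 ∣ suc m → TransRel m x x
transversal-same 3∤ = (λ _ → refl) , (λ 3∣ → ⊥-elim (3∤ 3∣))

transversal-twist : ∀ {k} (x : Vec Bool (2 + k)) → 3 ∣ 3 + k → TransRel (2 + k) x (twist x)
transversal-twist x 3∣ = (λ 3∤ → ⊥-elim (3∤ 3∣)) , (λ _ → twist-special x)

transversal-sym : ∀ {m} {x y : Vec Bool m} → TransRel m x y → TransRel m y x
transversal-sym (same , special) = (λ 3∤ → sym (same 3∤)) , (λ 3∣ → special-sym (special 3∣))

transversal-functional : ∀ {m} {x y z : Vec Bool m} → TransRel m x y → TransRel m x z → y ≡ z
transversal-functional {m} (same , special) (same' , special') with 3 ∣? suc m
... | yes 3∣ = trans (special⇒twist (special 3∣)) (sym (special⇒twist (special' 3∣)))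
... | no 3∤  = trans (sym (same 3∤)) (same' 3∤)

adj-irreflexive : ∀ m (x : Vec Bool m) → ¬ Adj m x x
adj-irreflexive (suc m) (a ∷ x) (inj₁ (_ , x~x)) = adj-irreflexive m x x~x
adj-irreflexive (suc m) (a ∷ x) (inj₂ (a≢a , _)) = a≢a refl

no-two-partners : ∀ {m} {x y z : Vec Bool m} → TransRel m x y → TransRel m x z → ¬ Adj m y z
no-two-partners {m} {y = y} x~y x~z y~z =
  adj-irreflexive m y (subst (Adj m y) (sym (transversal-functional x~y x~z)) y~z)

-- Among three bits two are equal: a triangle cannot have three transversal edges.
no-three-distinct : ∀ (a b c : Bool) → a ≢ b → b ≢ c → c ≢ a → ⊥
no-three-distinct false false _     a≢b _   _   = a≢b refl
no-three-distinct true  true  _     a≢b _   _   = a≢b refl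
no-three-distinct false true  true  _   b≢c _   = b≢c refl
no-three-distinct true  false false _   b≢c _   = b≢c refl
no-three-distinct false true  false _   _   c≢a = c≢a refl
no-three-distinct true  false true  _   _   c≢a = c≢a refl

triangle-free : ∀ m (x y z : Vec Bool m) → Adj m x y → Adj m y z → ¬ Adj m z x
triangle-free zero [] [] [] ()
triangle-free (suc m) (_ ∷ x) (_ ∷ y) (_ ∷ z) (inj₁ (refl , xy)) (inj₁ (refl , yz)) (inj₁ (refl , zx)) =
  triangle-free m x y z xy yz zx
triangle-free (suc m) (_ ∷ _) (_ ∷ _) (_ ∷ _) (inj₁ (refl , _)) (inj₁ (refl , _)) (inj₂ (ne , _)) = ne refl
triangle-free (suc m) (_ ∷ _) (_ ∷ _) (_ ∷ _) (inj₁ (refl , _)) (inj₂ (ne , _)) (inj₁ (refl , _)) = ne refl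
triangle-free (suc m) (_ ∷ _) (_ ∷ _) (_ ∷ _) (inj₂ (ne , _)) (inj₁ (refl , _)) (inj₁ (refl , _)) = ne refl
triangle-free (suc m) (_ ∷ _) (_ ∷ _) (_ ∷ _) (inj₁ (_ , xy)) (inj₂ (_ , yz)) (inj₂ (_ , zx)) =
  no-two-partners zx (transversal-sym yz) xy
triangle-free (suc m) (_ ∷ _) (_ ∷ _) (_ ∷ _) (inj₂ (_ , xy)) (inj₁ (_ , yz)) (inj₂ (_ , zx)) =
  no-two-partners xy (transversal-sym zx) yz
triangle-free (suc m) (_ ∷ _) (_ ∷ _) (_ ∷ _) (inj₂ (_ , xy)) (inj₂ (_ , yz)) (inj₁ (_ , zx)) =
  no-two-partners yz (transversal-sym xy) zx
triangle-free (suc m) (a ∷ _) (b ∷ _) (c ∷ _) (inj₂ (a≢b , _)) (inj₂ (b≢c , _)) (inj₂ (c≢a , _)) =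
  no-three-distinct a b c a≢b b≢c c≢a

inner-edge : ∀ {m a} {x y : Vec Bool m} → Adj (suc m) (a ∷ x) (a ∷ y) → Adj m x y
inner-edge (inj₁ (_ , x~y)) = x~y
inner-edge (inj₂ (a≢a , _)) = ⊥-elim (a≢a refl)

crossing-edge : ∀ {m a b} {x y : Vec Bool m} → ¬ 3 ∣ suc m → a ≢ b →
  Adj (suc m) (a ∷ x) (b ∷ y) → x ≡ y
crossing-edge _  a≢b (inj₁ (a≡b , _)) = ⊥-elim (a≢b a≡b)
crossing-edge 3∤ _   (inj₂ (_ , x~y)) = proj₁ x~y 3∤

-- When 3 ∤ n there is no path 1x, v₂, v₃, v₄, 0x avoiding the edge 0x–1x:
-- its leading bits must read 1, 1, ?, 0, 0, and dropping them leaves a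
-- triangle on x in VQ_m.
no-return-path : ∀ {m} {x : Vec Bool m} → ¬ 3 ∣ suc m → (v₂ v₃ v₄ : Vertex (suc m)) →
  v₂ ≢ false ∷ x → v₄ ≢ true ∷ x →
  Adj (suc m) (true ∷ x) v₂ → Adj (suc m) v₂ v₃ → Adj (suc m) v₃ v₄ → ¬ Adj (suc m) v₄ (false ∷ x)
no-return-path 3∤ (false ∷ t₂) _ _ v₂≢0x _ e₁₂ _ _ _ =
  v₂≢0x (cong (false ∷_) (sym (crossing-edge 3∤ (λ ()) e₁₂)))
no-return-path 3∤ (true ∷ t₂) _ (true ∷ t₄) _ v₄≢1x _ _ _ e₄₀ =
  v₄≢1x (cong (true ∷_) (crossing-edge 3∤ (λ ()) e₄₀))
no-return-path {m} {x} 3∤ (true ∷ t₂) (true ∷ t₃) (false ∷ t₄) _ _ e₁₂ e₂₃ e₃₄ e₄₀ =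
  triangle-free m x t₂ t₃ (inner-edge e₁₂) (inner-edge e₂₃)
    (subst (λ t → Adj m t x) (sym (crossing-edge 3∤ (λ ()) e₃₄)) (inner-edge e₄₀))
no-return-path {m} {x} 3∤ (true ∷ t₂) (false ∷ t₃) (false ∷ t₄) _ _ e₁₂ e₂₃ e₃₄ e₄₀ =
  triangle-free m x t₂ t₄ (inner-edge e₁₂)
    (subst (λ t → Adj m t t₄) (sym (crossing-edge 3∤ (λ ()) e₂₃)) (inner-edge e₃₄))
    (inner-edge e₄₀)

no-5-cycle : ∀ {m} {x : Vec Bool m} → ¬ 3 ∣ suc m → ¬ OnSomeCycle5 (suc m) (false ∷ x) (true ∷ x)
no-5-cycle {m} 3∤ ((f , f-inj , f-adj) , f₀ , f₁) =
  no-return-path 3∤ (f two) (f three) (f four)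
    (λ e → two≢zero (f-inj (trans e (sym f₀))))
    (λ e → four≢one (f-inj (trans e (sym f₁))))
    (subst (λ v → Adj (suc m) v (f two)) f₁ (f-adj one))
    (f-adj two) (f-adj three)
    (subst (Adj (suc m) (f four)) f₀ (f-adj four))
  where
  one two three four : Fin 5
  one   = suc zero
  two   = suc (suc zero)
  three = suc (suc (suc zero))
  four  = suc (suc (suc (suc zero)))
  two≢zero : two ≢ zero
  two≢zero ()
  four≢one : four ≢ one
  four≢one ()

module Pentagon {k : ℕ} (a b : Bool) (r : Vec Bool k) where

  vertex : Fin 5 → Vertex (3 + k)
  vertex zero                         = false ∷ a     ∷ b         ∷ r
  vertex (suc zero)                   = true  ∷ a     ∷ (a xor b) ∷ r
  vertex (suc (suc zero))             = true  ∷ not a ∷ (a xor b) ∷ r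
  vertex (suc (suc (suc zero)))       = false ∷ not a ∷ not b     ∷ r
  vertex (suc (suc (suc (suc zero)))) = false ∷ a     ∷ not b     ∷ r

  position : Bool → Bool → Bool → Fin 5
  position false false false = zero
  position true  false _     = suc zero
  position true  true  _     = suc (suc zero)
  position false true  _     = suc (suc (suc zero))
  position false false true  = suc (suc (suc (suc zero)))

  locate : Vertex (3 + k) → Fin 5
  locate (p ∷ q ∷ s ∷ _) = position p (a xor q) (b xor s)

  locate-vertex : ∀ i → locate (vertex i) ≡ i
  locate-vertex zero = cong₂ (position false) (xor-same a) (xor-same b)
  locate-vertex (suc zero) = cong (λ q → position true q (b xor (a xor b))) (xor-same a)
  locate-vertex (suc (suc zero)) = cong (λ q → position true q (b xor (a xor b))) (xor-inverseʳ a)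
  locate-vertex (suc (suc (suc zero))) = cong₂ (position false) (xor-inverseʳ a) (xor-inverseʳ b)
  locate-vertex (suc (suc (suc (suc zero)))) = cong₂ (position false) (xor-same a) (xor-inverseʳ b)

  vertex-injective : Injective _≡_ _≡_ vertex
  vertex-injective =
    inverseʳ⇒injective vertex (strictlyInverseʳ⇒inverseʳ {f⁻¹ = locate} vertex locate-vertex)

  -- Consecutive vertices are adjacent: two n-transversal edges, two
  -- (n-1)-transversal edges and one (n-2)-transversal edge, the last three
  -- of the plain kind since 3 ∣ n forces 3 ∤ n-1 and 3 ∤ n-2.
  vertex-adjacent : 3 ∣ 3 + k → ∀ i → Adj (3 + k) (vertex i) (vertex (next5 i))
  vertex-adjacent 3∣ zero =
    inj₂ ((λ ()) , transversal-twist (a ∷ b ∷ r) 3∣)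
  vertex-adjacent 3∣ (suc zero) =
    inj₁ (refl , inj₂ (≢-not , transversal-same (3∤n-1 3∣)))
  vertex-adjacent 3∣ (suc (suc zero)) =
    inj₂ ((λ ()) , subst (λ c → TransRel (2 + k) (not a ∷ (a xor b) ∷ r) (not a ∷ c ∷ r))
                         (not-xor-xor a b) (transversal-twist (not a ∷ (a xor b) ∷ r) 3∣))
  vertex-adjacent 3∣ (suc (suc (suc zero))) =
    inj₁ (refl , inj₂ (not-≢ , transversal-same (3∤n-1 3∣)))
  vertex-adjacent 3∣ (suc (suc (suc (suc zero)))) =
    inj₁ (refl , inj₁ (refl , inj₂ (not-≢ , transversal-same (3∤n-2 3∣))))

on-5-cycle : ∀ m (x : Vec Bool m) → 3 ∣ suc m → OnSomeCycle5 (suc m) (false ∷ x) (true ∷ twist x)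
on-5-cycle zero          []          3∣1 = ⊥-elim (3∤1 3∣1)
on-5-cycle (suc zero)    (_ ∷ [])    3∣2 = ⊥-elim (3∤2 3∣2)
on-5-cycle (suc (suc k)) (a ∷ b ∷ r) 3∣  =
  (vertex , vertex-injective , vertex-adjacent 3∣) , refl , refl
  where open Pentagon a b r

lemma2p4 : (m : ℕ) (x y : Vec Bool m) → TransRel m x y →
    ((3 ∣ suc m) → OnSomeCycle5 (suc m) (false ∷ x) (true ∷ y)) ×
    ((¬ (3 ∣ suc m)) → ¬ OnSomeCycle5 (suc m) (false ∷ x) (true ∷ y))
lemma2p4 m x y (same , special) = existence , non-existence
  where
  existence : 3 ∣ suc m → OnSomeCycle5 (suc m) (false ∷ x) (true ∷ y)
  existence 3∣ =
    subst (λ z → OnSomeCycle5 (suc m) (false ∷ x) (true ∷ z))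
          (sym (special⇒twist (special 3∣))) (on-5-cycle m x 3∣)

  non-existence : ¬ 3 ∣ suc m → ¬ OnSomeCycle5 (suc m) (false ∷ x) (true ∷ y)
  non-existence 3∤ =
    subst (λ z → ¬ OnSomeCycle5 (suc m) (false ∷ x) (true ∷ z)) (same 3∤) (no-5-cycle 3∤)
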